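{- Let $x$ be a binary word of length $n$ and let $1 \le i \le n$ with $\pi_x[i] \neq 0$. Then the length of the shortest non-empty abelian border of $x[1\cdots i]$ equals $i - \pi_x[i]$.
   Context: For a binary word $w$ over $\{0,1\}$, $ones(w)$ denotes the number of $1$'s in $w$. Two binary words of equal length are abelian equivalent if they have the same number of $1$'s. An abelian border of a binary word $w$ is a proper prefix of $w$ (a prefix different from $w$, possibly empty) that is abelian equivalent to the proper suffix of $w$ of the same length. For a binary word $x$ of length $n$, the abelian border array $\pi_x$ is the array of length $n$ with $\pi_x[i]$ ($1\le i\le n$) equal to the length of the longest abelian border of the prefix $x[1\cdots i]$. -}

module Defs where

open import Data.Bool using (Bool; true; false)
open import Data.Nat using (ℕ; zero; suc; _∸_; _<_; _≟_)
open import Data.Nat.Base using (_⊔_)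
open import Data.List using (List; []; _∷_; length; take; drop)
open import Relation.Binary.PropositionalEquality using (_≡_)
open import Relation.Nullary using (does)
open import Data.Product using (_×_)

-- binary words over {0,1}: false = 0, true = 1
Word : Set
Word = List Bool

ones : Word → ℕ
ones [] = 0
ones (true ∷ w) = suc (ones w)
ones (false ∷ w) = ones w

prefix : ℕ → Word → Word
prefix k w = take k w

suffix : ℕ → Word → Word
suffix k w = drop (length w ∸ k) w

-- k is the length of an abelian border of w:
-- a proper prefix of length k abelian equivalent to the suffix of length k
IsAbelianBorder : Word → ℕ → Set
IsAbelianBorder w k = (k < length w) × (ones (prefix k w) ≡ ones (suffix k w))

isAB : Word → ℕ → Bool
isAB w k = does (ones (prefix k w) ≟ ones (suffix k w))

-- largest k ≤ m with isAB w k (0 if none; k = 0 always is a border)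
largestAB≤ : Word → ℕ → ℕ
largestAB≤ w zero = zero
largestAB≤ w (suc m) with isAB w (suc m)
... | true = suc m
... | false = largestAB≤ w m

longestAbelianBorder : Word → ℕ
longestAbelianBorder w = largestAB≤ w (length w ∸ 1)

π : Word → ℕ → ℕ
π x i = longestAbelianBorder (take i x)

-- Since ones (prefix k w) + ones (suffix (n ∸ k) w) = ones w = ones (prefix (n ∸ k) w) + ones (suffix k w)
-- for a word w of length n, k is an abelian border length of w iff n ∸ k is. Hence the
-- complement n ∸ k reverses the order on border lengths in [1, n ∸ 1], and the shortest
-- non-empty border is the complement of the longest one.
module Submission where

open import Defs
open import Data.Bool using (true; false)
open import Data.Nat using (ℕ; zero; suc; _+_; _∸_; _≤_; _<_; z≤n; s≤s; _≟_)
open import Data.Nat.Properties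
open import Data.List using ([]; _∷_; _++_; length; take; drop)
open import Data.List.Properties using (length-take; take++drop≡id)
open import Data.Product using (_×_; _,_)
open import Data.Sum using (inj₁; inj₂)
open import Relation.Binary.PropositionalEquality
open import Relation.Nullary.Reflects using (Reflects; ofʸ; ofⁿ)
open import Relation.Nullary.Decidable using (proof)
open import Relation.Nullary.Negation using (contradiction)

Balanced : Word → ℕ → Set
Balanced w k = ones (prefix k w) ≡ ones (suffix k w)

IsShortestNonemptyAbelianBorder : Word → ℕ → Set
IsShortestNonemptyAbelianBorder w s =
  (1 ≤ s × IsAbelianBorder w s) × ((k : ℕ) → 1 ≤ k → IsAbelianBorder w k → s ≤ k)

ones-++ : ∀ u v → ones (u ++ v) ≡ ones u + ones v
ones-++ []          v = refl
ones-++ (true ∷ u)  v = cong suc (ones-++ u v)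
ones-++ (false ∷ u) v = ones-++ u v

ones-take+ones-drop : ∀ k w → ones (take k w) + ones (drop k w) ≡ ones w
ones-take+ones-drop k w = begin
  ones (take k w) + ones (drop k w) ≡⟨ ones-++ (take k w) (drop k w) ⟨
  ones (take k w ++ drop k w)       ≡⟨ cong ones (take++drop≡id k w) ⟩
  ones w                            ∎
  where open ≡-Reasoning

balanced-zero : ∀ w → Balanced w 0
balanced-zero []      = refl
balanced-zero (_ ∷ w) = balanced-zero w

balanced-complement : ∀ w {k} → k ≤ length w → Balanced w k → Balanced w (length w ∸ k)
balanced-complement w {k} k≤n pk≡sk rewrite m∸[m∸n]≡n k≤n =
  +-cancelʳ-≡ (ones (drop j w)) (ones (take j w)) (ones (drop k w)) (begin
    ones (take j w) + ones (drop j w) ≡⟨ ones-take+ones-drop j w ⟩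
    ones w                            ≡⟨ ones-take+ones-drop k w ⟨
    ones (take k w) + ones (drop k w) ≡⟨ cong (_+ ones (drop k w)) pk≡sk ⟩
    ones (drop j w) + ones (drop k w) ≡⟨ +-comm (ones (drop j w)) (ones (drop k w)) ⟩
    ones (drop k w) + ones (drop j w) ∎)
  where
  open ≡-Reasoning
  j = length w ∸ k

isAB-reflects : ∀ w k → Reflects (Balanced w k) (isAB w k)
isAB-reflects w k = proof (ones (prefix k w) ≟ ones (suffix k w))

largestAB≤-≤ : ∀ w m → largestAB≤ w m ≤ m
largestAB≤-≤ w zero = z≤n
largestAB≤-≤ w (suc m) with isAB w (suc m)
... | true  = ≤-refl
... | false = m≤n⇒m≤1+n (largestAB≤-≤ w m)

largestAB≤-balanced : ∀ w m → Balanced w (largestAB≤ w m)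
largestAB≤-balanced w zero = balanced-zero w
largestAB≤-balanced w (suc m) with isAB w (suc m) | isAB-reflects w (suc m)
... | true  | ofʸ balanced = balanced
... | false | _            = largestAB≤-balanced w m

largestAB≤-maximal : ∀ w {m k} → k ≤ m → Balanced w k → k ≤ largestAB≤ w m
largestAB≤-maximal w {zero}  k≤m _ = k≤m
largestAB≤-maximal w {suc m} {k} k≤m balanced with isAB w (suc m) | isAB-reflects w (suc m)
... | true  | _            = k≤m
... | false | ofⁿ ¬balanced with m≤n⇒m<n∨m≡n k≤m
...   | inj₁ (s≤s k≤m′) = largestAB≤-maximal w k≤m′ balanced
...   | inj₂ refl        = contradiction balanced ¬balanced

longestAbelianBorder-< : ∀ w → longestAbelianBorder w ≢ 0 → longestAbelianBorder w < length w
longestAbelianBorder-< w p≢0 = nonzero-≤pred⇒< p≢0 (largestAB≤-≤ w (length w ∸ 1))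
  where
  nonzero-≤pred⇒< : ∀ {m n} → m ≢ 0 → m ≤ n ∸ 1 → m < n
  nonzero-≤pred⇒< {n = suc _} _   m≤n = s≤s m≤n
  nonzero-≤pred⇒< {n = zero}  m≢0 z≤n = contradiction refl m≢0

shortestNonemptyAbelianBorder : ∀ w → longestAbelianBorder w ≢ 0 →
  IsShortestNonemptyAbelianBorder w (length w ∸ longestAbelianBorder w)
shortestNonemptyAbelianBorder w p≢0 =
  (m<n⇒0<n∸m p<n , ∸-monoʳ-< (n≢0⇒n>0 p≢0) (<⇒≤ p<n) , balanced-complement w (<⇒≤ p<n) p-balanced)
  , minimal
  where
  n = length w
  p = longestAbelianBorder w
  p<n = longestAbelianBorder-< w p≢0
  p-balanced = largestAB≤-balanced w (n ∸ 1)
  minimal : (k : ℕ) → 1 ≤ k → IsAbelianBorder w k → n ∸ p ≤ k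
  minimal k 1≤k (k<n , k-balanced) = begin
    n ∸ p       ≤⟨ ∸-monoʳ-≤ n (largestAB≤-maximal w (∸-monoʳ-≤ n 1≤k)
                     (balanced-complement w (<⇒≤ k<n) k-balanced)) ⟩
    n ∸ (n ∸ k) ≡⟨ m∸[m∸n]≡n (<⇒≤ k<n) ⟩
    k           ∎
    where open ≤-Reasoning

mainTheorem5 : (x : Word) (i : ℕ) → 1 ≤ i → i ≤ length x → π x i ≢ 0 →
    (1 ≤ i ∸ π x i × IsAbelianBorder (take i x) (i ∸ π x i))
    × ((k : ℕ) → 1 ≤ k → IsAbelianBorder (take i x) k → i ∸ π x i ≤ k)
mainTheorem5 x i _ i≤n πxi≢0 =
  subst (λ l → IsShortestNonemptyAbelianBorder (take i x) (l ∸ π x i)) length-prefix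
    (shortestNonemptyAbelianBorder (take i x) πxi≢0)
  where
  length-prefix : length (take i x) ≡ i
  length-prefix = trans (length-take i x) (m≤n⇒m⊓n≡m i≤n)
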